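{- Let $t_c,t_m$ be positive integers and $R\ge 0$ an integer. Greedy aggregation on the tree $T(R)$ (with the Token Network given by $T(R)$ and parameters $t_c,t_m$, every node starting with one token) terminates in $R$ rounds, i.e. after $R$ rounds the root holds a single token and no other token remains.
   Context: Token Network model: an undirected graph with integers $t_c,t_m$; synchronous rounds; each node starts with one token. A non-busy node holding $\ge1$ token may communicate (busy $t_m$ rounds, then one token is delivered to a neighbor); a non-busy node holding $\ge 2$ tokens may compute (busy $t_c$ rounds, then two of its tokens are replaced by one). A node may receive from several neighbors in one round. For a rooted tree $T_1$ with root $r$ and a tree $T_2$, $T_1 \textsc{ join } T_2$ is $T_1$ with $T_2$ attached as an additional subtree of $r$. $T(R)$ is a single node if $R<t_m+t_c$, and $T(R)=T(R-t_c)\textsc{ join }T(R-t_c-t_m)$ otherwise. Greedy aggregation on a tree rooted at $r$: in the first round every node except $r$ sends its token to its parent. In subsequent rounds: if a node is not busy and has at least two tokens, it computes; if a non-root node is not busy, has exactly one token, and has received a token from every child in previous rounds, it forwards its token to its parent. -}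

module Defs where

open import Data.Nat using (ℕ; zero; suc; _+_; _∸_; _<ᵇ_; _≡ᵇ_)
open import Data.Bool using (Bool; true; false; if_then_else_; _∧_; not)
open import Data.List using (List; []; _∷_; _++_; [_])
open import Data.Product using (_×_; _,_)

data Tree : Set where
  node : List Tree → Tree

leaf : Tree
leaf = node []

join : Tree → Tree → Tree
join (node ts) t = node (ts ++ [ t ])

-- T(R) for parameters tc tm.  Defined with fuel (fuel = R suffices when
-- tc ≥ 1, since the argument decreases by at least tc in each recursive call).
T-fuel : (tc tm : ℕ) → ℕ → ℕ → Tree
T-fuel tc tm zero     R = leaf
T-fuel tc tm (suc f) R =
  if R <ᵇ (tm + tc) then leaf
  else join (T-fuel tc tm f (R ∸ tc)) (T-fuel tc tm f (R ∸ tc ∸ tm))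

T : (tc tm : ℕ) → ℕ → Tree
T tc tm R = T-fuel tc tm R R

data Activity : Set where
  idle computing sending : Activity

record NState : Set where
  constructor nst
  field
    tokens    : ℕ
    busy      : ℕ        -- remaining busy rounds (0 = not busy)
    act       : Activity
    delivered : Bool     -- has delivered a token to its parent already

open NState public

data STree : Set where
  snode : NState → List STree → STree

initState : NState
initState = nst 1 0 idle false

mutual
  initS : Tree → STree
  initS (node ts) = snode initState (initSs ts)

  initSs : List Tree → List STree
  initSs []       = []
  initSs (t ∷ ts) = initS t ∷ initSs ts

-- Have all children delivered a token (in previous rounds)?
allDelivered : List STree → Bool
allDelivered []                   = true
allDelivered (snode s _ ∷ ts) = delivered s ∧ allDelivered ts

-- Decision at the start of a round (only if not busy):
--   ≥ 2 tokens → compute (busy tc rounds, two tokens consumed);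
--   non-root, exactly 1 token, received from every child → send to parent
--   (busy tm rounds, token leaves the node).
decide : (tc tm : ℕ) → (isRoot : Bool) → (allCh : Bool) → NState → NState
decide tc tm isRoot allCh (nst h (suc b) a d) = nst h (suc b) a d
decide tc tm isRoot allCh (nst (suc (suc h)) zero a d) = nst h tc computing d
decide tc tm isRoot allCh (nst (suc zero) zero a d) =
  if not isRoot ∧ allCh then nst zero tm sending d else nst (suc zero) zero idle d
decide tc tm isRoot allCh (nst zero zero a d) = nst zero zero idle d

-- Progress of one round of the busy period; returns the new state and whether
-- a token is delivered to the parent at the end of this round.
progress : NState → NState × Bool
progress (nst h zero a d) = nst h zero idle d , false
progress (nst h (suc zero) computing d) = nst (suc h) zero idle d , false
progress (nst h (suc zero) sending d)   = nst h zero idle true , true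
progress (nst h (suc zero) idle d)      = nst h zero idle d , false
progress (nst h (suc (suc b)) a d)      = nst h (suc b) a d , false

addTokens : ℕ → NState → NState
addTokens k (nst h b a d) = nst (h + k) b a d

mutual
  -- returns the new subtree and whether its root delivered a token to its
  -- parent at the end of this round
  stepT : (tc tm : ℕ) → Bool → STree → STree × Bool
  stepT tc tm isRoot (snode s cs) with stepTs tc tm cs
  ... | cs' , arrivals with progress (decide tc tm isRoot (allDelivered cs) s)
  ...   | s' , out = snode (addTokens arrivals s') cs' , out

  -- steps a list of children; returns them and the number of tokens they
  -- deliver to their parent at the end of this round
  stepTs : (tc tm : ℕ) → List STree → List STree × ℕ
  stepTs tc tm [] = [] , 0
  stepTs tc tm (c ∷ cs) with stepT tc tm false c | stepTs tc tm cs
  ... | c' , true  | cs' , k = c' ∷ cs' , suc k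
  ... | c' , false | cs' , k = c' ∷ cs' , k

step : (tc tm : ℕ) → STree → STree
step tc tm t with stepT tc tm true t
... | t' , _ = t'

run : (tc tm : ℕ) → Tree → ℕ → STree
run tc tm t zero    = initS t
run tc tm t (suc n) = step tc tm (run tc tm t n)

rootTokens : STree → ℕ
rootTokens (snode s _) = tokens s

-- tokens still present at a node: held tokens plus one token that is in
-- transit (node busy sending) or being produced (node busy computing)
nodeTokens : NState → ℕ
nodeTokens (nst h zero a d)    = h
nodeTokens (nst h (suc b) a d) = suc h

mutual
  totalTokens : STree → ℕ
  totalTokens (snode s cs) = nodeTokens s + totalTokensL cs

  totalTokensL : List STree → ℕ
  totalTokensL []       = 0
  totalTokensL (c ∷ cs) = totalTokens c + totalTokensL cs

TerminatedAfter : (tc tm : ℕ) → Tree → ℕ → Set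
TerminatedAfter tc tm t R =
  rootTokens (run tc tm t R) ≡ 1 × totalTokens (run tc tm t R) ≡ 1
  where open import Relation.Binary.PropositionalEquality using (_≡_)

-- Greedy aggregation is analysed through deadlines.  The root of T(R) must finish by
-- round R; a child followed by k later siblings must get its token to its parent by
-- round R − (k+1)·tc, i.e. start sending by R − (k+1)·tc − tm, and unfolding
-- T(R) = T(R − tc) join T(R − tc − tm) shows that this child is exactly
-- T(R − (k+1)·tc − tm).  A node with h surplus tokens and p children still to deliver
-- can meet its deadline as long as the current round plus its remaining busy time plus
-- tc·(h + p) is at most the deadline: every surplus token and every outstanding child
-- costs one computation.  An arriving token turns an outstanding child into a surplus
-- token, leaving h + p unchanged, and a node idling with one token still waits for a
-- child, whose own deadline provides the slack for that idle round.  At round R the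
-- root's invariant forces h = p = 0.
module Submission where

open import Defs
open import Data.Nat using (ℕ; _<_; zero; suc; _+_; _*_; _∸_; _≤_; z≤n; s≤s; _<ᵇ_; >-nonZero)
open import Data.Nat.Properties
open import Data.Bool using (Bool; true; false; not; _∧_) renaming (T to IsTrue)
open import Data.List using (List; []; _∷_; _++_; [_]; length)
open import Data.List.Properties using (length-++)
open import Data.Product using (_×_; _,_; proj₁; proj₂; ∃-syntax)
open import Data.Unit using (⊤; tt)
open import Data.Empty using (⊥-elim)
open import Function using (_∘_)
open import Relation.Binary.PropositionalEquality hiding ([_])
open import Algebra.Properties.CommutativeSemigroup +-commutativeSemigroup using (interchange)

toℕ : Bool → ℕ
toℕ false = 0
toℕ true  = 1

m+n+o≡m+[o+n] : ∀ m n o → m + n + o ≡ m + (o + n)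
m+n+o≡m+[o+n] m n o = trans (+-assoc m n o) (cong (m +_) (+-comm n o))

module _ (tc tm : ℕ) where

  -- The state s of a node at round n that can be done by round R (for a non-root: can
  -- have its token delivered by round R + tm) while p of its children still have to
  -- deliver.
  data OnTime (isRoot : Bool) (R n p : ℕ) : NState → Set where
    idle      : ∀ {h a} → n + tc * (h + p) ≤ R →
                OnTime isRoot R n p (nst (suc h) 0 a false)
    computing : ∀ {h c} → n + suc c + tc * (h + p) ≤ R →
                OnTime isRoot R n p (nst h (suc c) computing false)
    sending   : ∀ {c} → isRoot ≡ false → p ≡ 0 → n + suc c ≤ R + tm →
                OnTime isRoot R n p (nst 0 (suc c) sending false)
    done      : ∀ {a} → isRoot ≡ false → p ≡ 0 →
                OnTime isRoot R n p (nst 0 0 a true)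

  -- The same, for the state after the decision of round n and before its progress.
  data Committed (isRoot : Bool) (R n p : ℕ) : NState → Set where
    waiting   : n + tc * p < R →
                Committed isRoot R n p (nst 1 0 idle false)
    computing : ∀ {h c} → 0 < c → n + c + tc * (h + p) ≤ R →
                Committed isRoot R n p (nst h c computing false)
    sending   : ∀ {c} → 0 < c → isRoot ≡ false → p ≡ 0 → n + c ≤ R + tm →
                Committed isRoot R n p (nst 0 c sending false)
    done      : ∀ {a} → isRoot ≡ false → p ≡ 0 →
                Committed isRoot R n p (nst 0 0 a true)

  data ChildStatus (R n : ℕ) : ℕ → Bool → Set where
    allArrived : ChildStatus R n 0 true
    awaiting   : ∀ {p} → n + tc * p < R → ChildStatus R n p false

  notDelivered : NState → ℕ
  notDelivered s = toℕ (not (delivered s))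

  progress-committed : ∀ {b R n p s} → Committed b R n p s →
    OnTime b R (suc n) p (proj₁ (progress s)) ×
    notDelivered (proj₁ (progress s)) + toℕ (proj₂ (progress s)) ≡ notDelivered s
  progress-committed (waiting lt) = idle lt , refl
  progress-committed {n = n} {p} (computing {h} {suc zero} _ le) =
    idle (≤-trans (≤-reflexive (cong (_+ tc * (h + p)) (+-comm 1 n))) le) , refl
  progress-committed {n = n} {p} (computing {h} {suc (suc c)} _ le) =
    computing (≤-trans (≤-reflexive (cong (_+ tc * (h + p)) (sym (+-suc n (suc c))))) le) , refl
  progress-committed (sending {c = suc zero} _ r z _) = done r z , refl
  progress-committed {n = n} (sending {c = suc (suc c)} _ r z le) =
    sending r z (≤-trans (≤-reflexive (sym (+-suc n (suc c)))) le) , refl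
  progress-committed (done r z) = done r z , refl

  addTokens-onTime : ∀ {b R n p v k s} → OnTime b R n p s → p ≡ v + k → OnTime b R n v (addTokens k s)
  addTokens-onTime {n = n} {v = v} {k} (idle {h} le) refl =
    idle (≤-trans (≤-reflexive (cong (λ x → n + tc * x) (m+n+o≡m+[o+n] h k v))) le)
  addTokens-onTime {n = n} {v = v} {k} (computing {h} {c} le) refl =
    computing (≤-trans (≤-reflexive (cong (λ x → n + suc c + tc * x) (m+n+o≡m+[o+n] h k v))) le)
  addTokens-onTime {v = v} (sending r z le) refl with m+n≡0⇒n≡0 v z
  ... | refl = sending r (m+n≡0⇒m≡0 v z) le
  addTokens-onTime {v = v} (done r z) refl with m+n≡0⇒n≡0 v z
  ... | refl = done r (m+n≡0⇒m≡0 v z)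

  decide-delivered : ∀ b allCh s → delivered (decide tc tm b allCh s) ≡ delivered s
  decide-delivered b allCh (nst h (suc c) a d) = refl
  decide-delivered b allCh (nst (suc (suc h)) zero a d) = refl
  decide-delivered b allCh (nst (suc zero) zero a d) with not b ∧ allCh
  ... | true  = refl
  ... | false = refl
  decide-delivered b allCh (nst zero zero a d) = refl

  undelivered : STree → ℕ
  undelivered (snode s _) = notDelivered s

  pending : List STree → ℕ
  pending []       = 0
  pending (c ∷ cs) = undelivered c + pending cs

  pending≤length : ∀ cs → pending cs ≤ length cs
  pending≤length []                = z≤n
  pending≤length (snode s _ ∷ cs) with delivered s
  ... | true  = m≤n⇒m≤1+n (pending≤length cs)
  ... | false = s≤s (pending≤length cs)

  mutual
    OnSchedule : Bool → ℕ → ℕ → STree → Set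
    OnSchedule b R n (snode s cs) = OnTime b R n (pending cs) s × ChildrenOnSchedule R n cs

    ChildrenOnSchedule : ℕ → ℕ → List STree → Set
    ChildrenOnSchedule R n []       = ⊤
    ChildrenOnSchedule R n (c ∷ cs) =
      (∃[ Rc ] Rc + tm + tc * suc (length cs) ≤ R × OnSchedule false Rc n c) ×
      ChildrenOnSchedule R n cs

  mutual
    totalTokens≡0 : ∀ {R n} t → OnSchedule false R n t → undelivered t ≡ 0 → totalTokens t ≡ 0
    totalTokens≡0 (snode _ cs) (done _ p≡0 , ch) _ = totalTokensL≡0 cs ch p≡0
    totalTokens≡0 (snode _ _)  (idle _ , _)        ()
    totalTokens≡0 (snode _ _)  (computing _ , _)   ()
    totalTokens≡0 (snode _ _)  (sending _ _ _ , _) ()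

    totalTokensL≡0 : ∀ {R n} cs → ChildrenOnSchedule R n cs → pending cs ≡ 0 → totalTokensL cs ≡ 0
    totalTokensL≡0 []       _                     _ = refl
    totalTokensL≡0 (c ∷ cs) ((_ , _ , onSch) , ch) e =
      cong₂ _+_ (totalTokens≡0 c onSch (m+n≡0⇒m≡0 _ e)) (totalTokensL≡0 cs ch (m+n≡0⇒n≡0 _ e))

  tc*length≤deadline : ∀ {R n} cs → ChildrenOnSchedule R n cs → tc * length cs ≤ R
  tc*length≤deadline []       _                 = ≤-trans (≤-reflexive (*-zeroʳ tc)) z≤n
  tc*length≤deadline (c ∷ cs) ((Rc , le , _) , _) = ≤-trans (m≤n+m _ (Rc + tm)) le

  children-snoc : ∀ {R S Rc n} cs c → ChildrenOnSchedule R n cs → R + tc ≤ S →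
    Rc + tm + tc ≤ S → OnSchedule false Rc n c → ChildrenOnSchedule S n (cs ++ [ c ])
  children-snoc {S = S} {Rc} [] c _ _ le onSch =
    (Rc , subst (_≤ S) (cong (Rc + tm +_) (sym (*-identityʳ tc))) le , onSch) , tt
  children-snoc (c′ ∷ cs) c ((Rc′ , le′ , onSch′) , ch) R+tc≤S le onSch =
    (Rc′ , ≤-trans (≤-reflexive later-deadline) (≤-trans (+-monoˡ-≤ tc le′) R+tc≤S) , onSch′) ,
    children-snoc cs c ch R+tc≤S le onSch
    where
      L = length cs
      later-deadline : Rc′ + tm + tc * suc (length (cs ++ [ c ])) ≡ Rc′ + tm + tc * suc L + tc
      later-deadline = begin
        Rc′ + tm + tc * suc (length (cs ++ [ c ])) ≡⟨ cong (λ x → Rc′ + tm + tc * suc x) (trans (length-++ cs) (+-comm L 1)) ⟩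
        Rc′ + tm + tc * suc (suc L)                ≡⟨ cong (Rc′ + tm +_) (trans (*-suc tc (suc L)) (+-comm tc _)) ⟩
        Rc′ + tm + (tc * suc L + tc)               ≡⟨ +-assoc (Rc′ + tm) _ tc ⟨
        Rc′ + tm + tc * suc L + tc                 ∎
        where open ≡-Reasoning

  initSs-++ : ∀ ts t → initSs (ts ++ [ t ]) ≡ initSs ts ++ [ initS t ]
  initSs-++ []       t = refl
  initSs-++ (t′ ∷ ts) t = cong (initS t′ ∷_) (initSs-++ ts t)

  initS-onSchedule : ∀ b S ts → ChildrenOnSchedule S 0 (initSs ts) → OnSchedule b S 0 (initS (node ts))
  initS-onSchedule b S ts ch =
    idle (≤-trans (*-monoʳ-≤ tc (pending≤length (initSs ts))) (tc*length≤deadline _ ch)) , ch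

  T-fuel-onSchedule : ∀ b f S → OnSchedule b S 0 (initS (T-fuel tc tm f S))
  T-fuel-onSchedule b zero    S = initS-onSchedule b S [] tt
  T-fuel-onSchedule b (suc f) S with S <ᵇ tm + tc in S≮tm+tc
  ... | true  = initS-onSchedule b S [] tt
  ... | false with T-fuel tc tm f (S ∸ tc) | T-fuel-onSchedule false f (S ∸ tc)
  ...   | node ts | (_ , ch) =
    initS-onSchedule b S (ts ++ [ _ ])
      (subst (ChildrenOnSchedule S 0) (sym (initSs-++ ts _))
        (children-snoc _ _ ch (≤-reflexive S∸tc+tc≡S) (≤-reflexive S∸tc∸tm+tm+tc≡S)
          (T-fuel-onSchedule false f (S ∸ tc ∸ tm))))
    where
      tm+tc≤S : tm + tc ≤ S
      tm+tc≤S = ≮⇒≥ (λ lt → subst IsTrue S≮tm+tc (<⇒<ᵇ lt))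
      S∸tc+tc≡S : S ∸ tc + tc ≡ S
      S∸tc+tc≡S = m∸n+n≡m (m+n≤o⇒n≤o tm tm+tc≤S)
      S∸tc∸tm+tm+tc≡S : S ∸ tc ∸ tm + tm + tc ≡ S
      S∸tc∸tm+tm+tc≡S = trans (cong (_+ tc) (m∸n+n≡m (m+n≤o⇒m≤o∸n tm tm+tc≤S))) S∸tc+tc≡S

  stepT-snode : ∀ b s cs → stepT tc tm b (snode s cs) ≡
    ( snode (addTokens (proj₂ (stepTs tc tm cs)) (proj₁ (progress (decide tc tm b (allDelivered cs) s))))
            (proj₁ (stepTs tc tm cs))
    , proj₂ (progress (decide tc tm b (allDelivered cs) s)))
  stepT-snode b s cs with stepTs tc tm cs
  ... | _ with progress (decide tc tm b (allDelivered cs) s)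
  ...   | _ = refl

  stepTs-∷ : ∀ c cs → stepTs tc tm (c ∷ cs) ≡
    ( proj₁ (stepT tc tm false c) ∷ proj₁ (stepTs tc tm cs)
    , toℕ (proj₂ (stepT tc tm false c)) + proj₂ (stepTs tc tm cs))
  stepTs-∷ c cs with stepT tc tm false c | stepTs tc tm cs
  ... | _ , true  | _ = refl
  ... | _ , false | _ = refl

  stepTs-length : ∀ cs → length (proj₁ (stepTs tc tm cs)) ≡ length cs
  stepTs-length []       = refl
  stepTs-length (c ∷ cs) rewrite stepTs-∷ c cs = cong suc (stepTs-length cs)

  step-stepT : ∀ t → step tc tm t ≡ proj₁ (stepT tc tm true t)
  step-stepT t with stepT tc tm true t
  ... | _ = refl

  module _ (tc>0 : 0 < tc) (tm>0 : 0 < tm) where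

    decide-committed : ∀ {b R n p allCh s} → OnTime b R n p s → ChildStatus R n p allCh →
      (b ≡ true → n < R) → Committed b R n p (decide tc tm b allCh s)
    decide-committed {n = n} {p} (idle {suc h} le) _ _ =
      computing tc>0 (≤-trans (≤-reflexive start-computing) le)
      where
        start-computing : n + tc + tc * (h + p) ≡ n + tc * (suc h + p)
        start-computing = trans (+-assoc n tc _) (cong (n +_) (sym (*-suc tc (h + p))))
    decide-committed {true}  (idle {zero} _) (awaiting lt) _ = waiting lt
    decide-committed {false} (idle {zero} _) (awaiting lt) _ = waiting lt
    decide-committed {true} {n = n} (idle {zero} _) allArrived n<R =
      waiting (subst (_< _) (sym (trans (cong (n +_) (*-zeroʳ tc)) (+-identityʳ n))) (n<R refl))
    decide-committed {false} {n = n} (idle {zero} le) allArrived _ =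
      sending tm>0 refl refl (+-monoˡ-≤ tm (m+n≤o⇒m≤o n le))
    decide-committed (computing le)   _ _ = computing (s≤s z≤n) le
    decide-committed (sending r z le) _ _ = sending (s≤s z≤n) r z le
    decide-committed (done r z)       _ _ = done r z

    undelivered-deadline : ∀ {R n p s} → OnTime false R n p s → delivered s ≡ false → n < R + tm
    undelivered-deadline {n = n} (idle le) _ = ≤-<-trans (m+n≤o⇒m≤o n le) (m<m+n _ tm>0)
    undelivered-deadline {n = n} (computing le) _ =
      <-≤-trans (m<m+n n (s≤s z≤n)) (≤-trans (m+n≤o⇒m≤o _ le) (m≤m+n _ tm))
    undelivered-deadline {n = n} (sending _ _ le) _ = <-≤-trans (m<m+n n (s≤s z≤n)) le

    childStatus : ∀ {R n} cs → ChildrenOnSchedule R n cs → ChildStatus R n (pending cs) (allDelivered cs)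
    childStatus []                 _ = allArrived
    childStatus (snode s _ ∷ cs) ((_ , le , onSch , _) , ch) with delivered s in undelivered-s
    ... | true  = childStatus cs ch
    ... | false =
      awaiting (≤-trans (+-mono-≤ (undelivered-deadline onSch undelivered-s)
                                  (*-monoʳ-≤ tc (s≤s (pending≤length cs)))) le)

    mutual
      stepT-onSchedule : ∀ b {R n} t → OnSchedule b R n t → (b ≡ true → n < R) →
        OnSchedule b R (suc n) (proj₁ (stepT tc tm b t)) ×
        undelivered (proj₁ (stepT tc tm b t)) + toℕ (proj₂ (stepT tc tm b t)) ≡ undelivered t
      stepT-onSchedule b (snode s cs) (onTime , ch) root-slack rewrite stepT-snode b s cs
        with stepTs-onSchedule cs ch
      ... | ch′ , arrivals =
        let onTime′ , delivery = progress-committed (decide-committed onTime (childStatus cs ch) root-slack)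
        in (addTokens-onTime onTime′ (sym arrivals) , ch′) ,
           trans delivery (cong (toℕ ∘ not) (decide-delivered b (allDelivered cs) s))

      stepTs-onSchedule : ∀ {R n} cs → ChildrenOnSchedule R n cs →
        ChildrenOnSchedule R (suc n) (proj₁ (stepTs tc tm cs)) ×
        pending (proj₁ (stepTs tc tm cs)) + proj₂ (stepTs tc tm cs) ≡ pending cs
      stepTs-onSchedule []       _ = tt , refl
      stepTs-onSchedule {R} (c ∷ cs) ((Rc , le , onSch) , ch) rewrite stepTs-∷ c cs
        with stepT-onSchedule false c onSch (λ ()) | stepTs-onSchedule cs ch
      ... | onSch′ , delivery | ch′ , arrivals =
        ((Rc , subst (λ L → Rc + tm + tc * suc L ≤ R) (sym (stepTs-length cs)) le , onSch′) , ch′) ,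
        interchange-≡ (undelivered (proj₁ (stepT tc tm false c))) (pending (proj₁ (stepTs tc tm cs)))
          delivery arrivals
        where
          interchange-≡ : ∀ a′ p′ {o a k p} → a′ + o ≡ a → p′ + k ≡ p → a′ + p′ + (o + k) ≡ a + p
          interchange-≡ a′ p′ {o} {k = k} refl refl = interchange a′ p′ o k

    run-onSchedule : ∀ R n → n ≤ R → OnSchedule true R n (run tc tm (T tc tm R) n)
    run-onSchedule R zero    _   = T-fuel-onSchedule true R R
    run-onSchedule R (suc n) n<R rewrite step-stepT (run tc tm (T tc tm R) n) =
      proj₁ (stepT-onSchedule true _ (run-onSchedule R n (<⇒≤ n<R)) (λ _ → n<R))

    onSchedule-at-deadline : ∀ {R} t → OnSchedule true R R t → rootTokens t ≡ 1 × totalTokens t ≡ 1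
    onSchedule-at-deadline {R} (snode _ cs) (idle {h} le , ch)
      with m+n≡0⇒m≡0 h no-work | m+n≡0⇒n≡0 h no-work
      where
        tc*work≡0 : tc * (h + pending cs) ≡ 0
        tc*work≡0 = n≤0⇒n≡0 (+-cancelˡ-≤ R _ 0 (subst (R + tc * (h + pending cs) ≤_) (sym (+-identityʳ R)) le))
        no-work : h + pending cs ≡ 0
        no-work = m*n≡0⇒m≡0 _ tc {{>-nonZero tc>0}} (trans (*-comm _ tc) tc*work≡0)
    ... | refl | p≡0 = refl , cong suc (totalTokensL≡0 cs ch p≡0)
    onSchedule-at-deadline {R} (snode _ _) (computing le , _) = ⊥-elim (m+1+n≰m R (m+n≤o⇒m≤o _ le))
    onSchedule-at-deadline (snode _ _) (sending () _ _ , _)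
    onSchedule-at-deadline (snode _ _) (done () _ , _)

lemma1 : (tc tm : ℕ) → 0 < tc → 0 < tm → (R : ℕ) → TerminatedAfter tc tm (T tc tm R) R
lemma1 tc tm tc>0 tm>0 R = onSchedule-at-deadline tc tm tc>0 tm>0 _ (run-onSchedule tc tm tc>0 tm>0 R R ≤-refl)
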